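{- There is a family of linear polynomials $P_\theta\in\mathbb{Z}[X_{\alpha_1},\dots,X_{\alpha_n}]$, $\theta\in\Phi^+$, with $P_{\alpha_i}=X_{\alpha_i}$ for simple roots, such that: 1) for every $\theta\in\Phi^+\setminus\Delta$, $P_\theta$ has positive coefficients, and for every $w\in W_a$ there is $\lambda_\theta(w)\in\{0,1,\dots,h(\theta^\vee)-1\}$ with $k(w,\theta)=P_\theta(w)+\lambda_\theta(w)$; 2) $P_\theta=P_\alpha+P_\beta$ for all $\alpha,\beta,\theta\in\Phi^+$ with $\theta^\vee=\alpha^\vee+\beta^\vee$.
   Context: Let $V$ be a Euclidean space with inner product $(\cdot,\cdot)$ and $\Phi\subset V$ an irreducible crystallographic root system spanning $V$, short roots of norm $1$; $\Delta=\{\alpha_1,\dots,\alpha_n\}$ a simple system, $\Phi^+$ the positive roots. For $\alpha\in\Phi$, $\alpha^\vee=2\alpha/(\alpha,\alpha)$; the coroots form a root system $\Phi^\vee$ with simple system $\{\alpha_i^\vee\}$, and the height of $\theta^\vee=\sum_ic_i\alpha_i^\vee$ is $h(\theta^\vee)=\sum_ic_i$. For $k\in\mathbb{Z}$, $s_{\alpha,k}(x)=x-\big(\tfrac{2(\alpha,x)}{(\alpha,\alpha)}-k\big)\alpha$; $W_a=\langle s_{\alpha,k}\rangle\subset\mathrm{Aff}(V)$. For $\alpha\in\Phi^+$, $k\in\mathbb{Z}$, $H^1_{\alpha,k}=\{x: k<(x,\alpha^\vee)<k+1\}$; alcoves are connected components of $V$ minus all hyperplanes $\{(x,\alpha^\vee)=k\}$,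 $A_e=\bigcap_{\alpha\in\Phi^+}H^1_{\alpha,0}$, $A_w=w(A_e)$, and $k(w,\alpha)$ are the integers with $A_w=\bigcap_{\alpha\in\Phi^+}H^1_{\alpha,k(w,\alpha)}$. For $Q\in\mathbb{Z}[X_{\alpha_1},\dots,X_{\alpha_n}]$ and $w\in W_a$, $Q(w):=Q(k(w,\alpha_1),\dots,k(w,\alpha_n))$.
   Formalization: The Euclidean space V is taken as ℚ^d with a rational inner product, so the roots in Φ and the points of the alcoves have rational coordinates. -}

module Defs where

open import Data.Nat using (ℕ; zero; suc)
open import Data.Integer as ℤ using (ℤ; +_; -[1+_])
open import Data.Rational as ℚ using (ℚ; mkℚ; 0ℚ; 1ℚ; _+_; _*_; _-_; -_; _≤_; _<_; 1/_)
open import Data.Fin using (Fin; zero; suc)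
open import Data.Bool using (Bool; true; false)
open import Data.List using (List; []; _∷_)
open import Data.Product using (Σ; ∃; _×_; _,_)
open import Data.Sum using (_⊎_)
open import Relation.Binary.PropositionalEquality using (_≡_; _≢_)
open import Relation.Nullary using (¬_)

Vect : ℕ → Set
Vect d = Fin d → ℚ

∑ : ∀ {d} → (Fin d → ℚ) → ℚ
∑ {zero}  f = 0ℚ
∑ {suc d} f = f zero + ∑ (λ i → f (suc i))

∑ℤ : ∀ {d} → (Fin d → ℤ) → ℤ
∑ℤ {zero}  f = + 0
∑ℤ {suc d} f = f zero ℤ.+ ∑ℤ (λ i → f (suc i))

ι : ℤ → ℚ
ι k = k ℚ./ 1

-- total inverse (inverse of 0 is 0; only ever used on nonzero arguments)
inv : ℚ → ℚ
inv p@(mkℚ (+ zero) _ _)    = 0ℚ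
inv p@(mkℚ (+ suc n) _ _)   = 1/ p
inv p@(mkℚ -[1+ n ] _ _)    = 1/ p

2ℚ : ℚ
2ℚ = + 2 ℚ./ 1

module _ {d : ℕ} where
  0v : Vect d
  0v _ = 0ℚ

  _+v_ : Vect d → Vect d → Vect d
  (x +v y) i = x i + y i

  _-v_ : Vect d → Vect d → Vect d
  (x -v y) i = x i - y i

  _•_ : ℚ → Vect d → Vect d
  (c • x) i = c * x i

  -v_ : Vect d → Vect d
  (-v x) i = - x i

  _≈_ : Vect d → Vect d → Set
  x ≈ y = ∀ i → x i ≡ y i

  lincomb : ∀ {k} → (Fin k → ℚ) → (Fin k → Vect d) → Vect d
  lincomb c v j = ∑ (λ i → c i * v i j)

-- A rational Euclidean space: ℚ^d with a symmetric positive definite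
-- bilinear form given by its Gram matrix B.

Gram : ℕ → Set
Gram d = Fin d → Fin d → ℚ

⟨_∣_,_⟩ : ∀ {d} → Gram d → Vect d → Vect d → ℚ
⟨ B ∣ x , y ⟩ = ∑ (λ i → ∑ (λ j → x i * B i j * y j))

IsInnerProduct : ∀ {d} → Gram d → Set
IsInnerProduct {d} B =
  (∀ i j → B i j ≡ B j i) ×
  (∀ (x : Vect d) → ¬ (x ≈ 0v) → 0ℚ < ⟨ B ∣ x , x ⟩)

module _ {d : ℕ} (B : Gram d) where
  coroot : Vect d → Vect d
  coroot α = (2ℚ * inv ⟨ B ∣ α , α ⟩) • α

  sRefl : Vect d → ℤ → Vect d → Vect d
  sRefl α k x = x -v ((2ℚ * ⟨ B ∣ α , x ⟩ * inv ⟨ B ∣ α , α ⟩ - ι k) • α)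

-- Crystallographic root systems, given as a finite family Φ : Fin m → V
-- (injective) in ℚ^d with inner product B.

module _ {d m : ℕ} (B : Gram d) (Φ : Fin m → Vect d) where

  InΦ : Vect d → Set
  InΦ x = ∃ λ a → Φ a ≈ x

  IsRootSystem : Set
  IsRootSystem =
    -- Φ is a finite set (enumerated without repetition)
    (∀ a b → Φ a ≈ Φ b → a ≡ b) ×
    (∀ (x : Vect d) → ∃ λ (c : Fin m → ℚ) → x ≈ lincomb c Φ) ×
    (∀ a → ¬ (Φ a ≈ 0v)) ×
    (∀ a (c : ℚ) → InΦ (c • Φ a) → (c ≡ 1ℚ ⊎ c ≡ - 1ℚ)) ×
    (∀ a b → InΦ (sRefl B (Φ a) (+ 0) (Φ b))) ×
    (∀ a b → ∃ λ (k : ℤ) → ⟨ B ∣ Φ b , coroot B (Φ a) ⟩ ≡ ι k)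

  IsIrreducible : Set
  IsIrreducible =
    ∀ (col : Fin m → Bool) →
      (∀ a b → col a ≡ true → col b ≡ false → ⟨ B ∣ Φ a , Φ b ⟩ ≡ 0ℚ) →
      (∀ a → col a ≡ true) ⊎ (∀ a → col a ≡ false)

  ShortRootsNormOne : Set
  ShortRootsNormOne =
    (∀ a → 1ℚ ≤ ⟨ B ∣ Φ a , Φ a ⟩) × (∃ λ a → ⟨ B ∣ Φ a , Φ a ⟩ ≡ 1ℚ)

  module _ {n : ℕ} (Δ : Fin n → Fin m) where
    simple : Fin n → Vect d
    simple i = Φ (Δ i)

    NonnegComb : Vect d → Set
    NonnegComb x = ∃ λ (c : Fin n → ℚ) → (∀ i → 0ℚ ≤ c i) × (x ≈ lincomb c simple)

    IsSimpleSystem : Set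
    IsSimpleSystem =
      (∀ (c : Fin n → ℚ) → lincomb c simple ≈ 0v → ∀ i → c i ≡ 0ℚ) ×
      (∀ (x : Vect d) → ∃ λ (c : Fin n → ℚ) → x ≈ lincomb c simple) ×
      (∀ a → NonnegComb (Φ a) ⊎ NonnegComb (-v Φ a))

    Positive : Fin m → Set
    Positive a = NonnegComb (Φ a)

    IsSimpleRoot : Fin m → Set
    IsSimpleRoot a = ∃ λ i → Δ i ≡ a

    -- θ^∨ = Σ_i c_i α_i^∨ and h(θ^∨) = Σ_i c_i  (as a relation)
    CorootHeight : Fin m → ℚ → Set
    CorootHeight a h = ∃ λ (c : Fin n → ℚ) →
      (coroot B (Φ a) ≈ lincomb c (λ i → coroot B (simple i))) × (h ≡ ∑ c)

    -- elements of the affine Weyl group W_a, as words in the generators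
    -- s_{α,k} (α ∈ Φ, k ∈ ℤ)
    Word : Set
    Word = List (Fin m × ℤ)

    act : Word → Vect d → Vect d
    act []            x = x
    act ((a , k) ∷ w) x = sRefl B (Φ a) k (act w x)

    InAe : Vect d → Set
    InAe x = ∀ a → Positive a →
      (0ℚ < ⟨ B ∣ x , coroot B (Φ a) ⟩) × (⟨ B ∣ x , coroot B (Φ a) ⟩ < 1ℚ)

    -- k(w,α) = k  :  A_w = w(A_e) ⊆ H^1_{α,k}, i.e. k < (y, α^∨) < k+1 on A_w
    IsK : Word → Fin m → ℤ → Set
    IsK w a k = ∀ x → InAe x →
      (ι k < ⟨ B ∣ act w x , coroot B (Φ a) ⟩) ×
      (⟨ B ∣ act w x , coroot B (Φ a) ⟩ < ι (k ℤ.+ + 1))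

-- a linear form Σ_j p_j X_{α_j} in ℤ[X_{α_1},…,X_{α_n}] (coefficient vector)
LinPoly : ℕ → Set
LinPoly n = Fin n → ℤ

Xvar : ∀ {n} → Fin n → LinPoly n
Xvar i j with Data.Fin._≟_ i j
... | Relation.Nullary.yes _ = + 1
... | Relation.Nullary.no  _ = + 0

evalP : ∀ {n} → LinPoly n → (Fin n → ℤ) → ℤ
evalP p ks = ∑ℤ (λ j → p j ℤ.* ks j)

-- For a positive root θ = ∑ⱼ cⱼ αⱼ pick j with cⱼ > 0 and ⟪θ , αⱼ⟫ > 0. Unless θ = αⱼ, the reflection sⱼθ is
-- again positive, of height ∑ⱼ cⱼ - ⟪θ , αⱼ∨⟫ ≤ ∑ⱼ cⱼ - 1, and θ∨ = (sⱼθ)∨ + ⟪αⱼ , θ∨⟫ αⱼ∨ with ⟪αⱼ , θ∨⟫ ∈ ℕ.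
-- Descending this way writes θ∨ = ∑ⱼ pⱼ αⱼ∨ with pⱼ ∈ ℕ, and P_θ = ∑ⱼ pⱼ X_{αⱼ}; additivity is uniqueness of
-- coordinates in the basis of simple coroots. A point x of A_w has kⱼ < ⟪x , αⱼ∨⟫ < kⱼ + 1, so
-- P_θ(w) ≤ ⟪x , θ∨⟫ ≤ P_θ(w) + h(θ∨), which pins down k(w,θ). Such a point exists because A_e contains a
-- multiple of the sum 2ρ of the positive roots: ⟪2ρ , αᵢ⟫ > 0 since sᵢ only moves αᵢ across the sign divide.
module Submission where

open import Defs
open import Data.Nat using (ℕ)
open import Data.Integer as ℤ using (ℤ; +_)
open import Data.Rational using (ℚ; _<_)
open import Data.Fin using (Fin)
open import Data.Product using (Σ; ∃; _×_; _,_)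
open import Relation.Binary.PropositionalEquality using (_≡_)
open import Relation.Nullary using (¬_)

open import Algebra.Bundles using (CommutativeRing)
open import Data.Nat as ℕ using (zero; suc)
open import Data.Integer using (-[1+_])
import Data.Integer.Properties as ℤP
open import Data.Integer.Solver using () renaming (module +-*-Solver to ℤ-Solver)
open import Data.Rational as ℚ using (mkℚ; 0ℚ; 1ℚ; _+_; _*_; _-_; -_; _≤_; 1/_; toℚᵘ)
import Data.Rational.Properties as ℚP
open import Algebra.Properties.Group ℚP.+-0-group using (x∙y⁻¹≈ε⇒x≈y; ⁻¹-involutive)
open import Data.Rational.Solver using () renaming (module +-*-Solver to ℚ-Solver)
import Data.Rational.Unnormalised as ℚᵘ
import Data.Rational.Unnormalised.Properties as ℚᵘP
open import Data.Fin as Fin using (zero; suc)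
import Data.Fin.Properties as FinP
import Data.Nat.Properties as ℕP
import Data.Fin.Permutation as Perm
import Data.Nat.Coprimality as C
open import Data.Product using (proj₁; proj₂)
open import Data.Sum using (_⊎_; inj₁; inj₂; [_,_]′)
open import Data.Empty using (⊥; ⊥-elim)
open import Function using (_∘_; id; case_of_)
open import Relation.Nullary using (Dec; yes; no; ¬?; _×-dec_)
open import Relation.Binary.PropositionalEquality
  using (_≢_; refl; sym; trans; cong; cong₂; subst; subst₂; module ≡-Reasoning)

import Algebra.Properties.Semiring.Sum as SemiringSum
module ΣQ = SemiringSum (CommutativeRing.semiring ℚP.+-*-commutativeRing)

ι-toℚᵘ : ∀ k → toℚᵘ (ι k) ℚᵘ.≃ ℚᵘ.mkℚᵘ k 0
ι-toℚᵘ k = ℚP.toℚᵘ-fromℚᵘ (ℚᵘ.mkℚᵘ k 0)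

ι≡mkℚ : ∀ k → ι k ≡ mkℚ k 0 (C.sym (C.1-coprimeTo ℤ.∣ k ∣))
ι≡mkℚ k = ℚP.toℚᵘ-injective (ι-toℚᵘ k)

ι-homo-+ : ∀ a b → ι (a ℤ.+ b) ≡ ι a + ι b
ι-homo-+ a b = ℚP.toℚᵘ-injective (begin
  toℚᵘ (ι (a ℤ.+ b))                 ≈⟨ ι-toℚᵘ (a ℤ.+ b) ⟩
  ℚᵘ.mkℚᵘ (a ℤ.+ b) 0
    ≈⟨ ℚᵘ.*≡* (solve 2 (λ x y → (x :+ y) :* con (+ 1) := (x :* con (+ 1) :+ y :* con (+ 1)) :* con (+ 1)) refl a b) ⟩
  ℚᵘ.mkℚᵘ a 0 ℚᵘ.+ ℚᵘ.mkℚᵘ b 0        ≈⟨ ℚᵘP.+-cong (ℚᵘP.≃-sym (ι-toℚᵘ a)) (ℚᵘP.≃-sym (ι-toℚᵘ b)) ⟩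
  toℚᵘ (ι a) ℚᵘ.+ toℚᵘ (ι b)          ≈⟨ ℚᵘP.≃-sym (ℚP.toℚᵘ-homo-+ (ι a) (ι b)) ⟩
  toℚᵘ (ι a + ι b)                   ∎)
  where open ℚᵘP.≃-Reasoning
        open ℤ-Solver

ι-homo-* : ∀ a b → ι (a ℤ.* b) ≡ ι a * ι b
ι-homo-* a b = ℚP.toℚᵘ-injective (begin
  toℚᵘ (ι (a ℤ.* b))                 ≈⟨ ι-toℚᵘ (a ℤ.* b) ⟩
  ℚᵘ.mkℚᵘ (a ℤ.* b) 0                 ≈⟨ ℚᵘ.*≡* refl ⟩
  ℚᵘ.mkℚᵘ a 0 ℚᵘ.* ℚᵘ.mkℚᵘ b 0        ≈⟨ ℚᵘP.*-cong (ℚᵘP.≃-sym (ι-toℚᵘ a)) (ℚᵘP.≃-sym (ι-toℚᵘ b)) ⟩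
  toℚᵘ (ι a) ℚᵘ.* toℚᵘ (ι b)          ≈⟨ ℚᵘP.≃-sym (ℚP.toℚᵘ-homo-* (ι a) (ι b)) ⟩
  toℚᵘ (ι a * ι b)                   ∎)
  where open ℚᵘP.≃-Reasoning

ι-mono-≤ : ∀ {a b} → a ℤ.≤ b → ι a ≤ ι b
ι-mono-≤ {a} {b} a≤b rewrite ι≡mkℚ a | ι≡mkℚ b =
  ℚ.*≤* (subst₂ ℤ._≤_ (sym (ℤP.*-identityʳ a)) (sym (ℤP.*-identityʳ b)) a≤b)

ι-cancel-≤ : ∀ {a b} → ι a ≤ ι b → a ℤ.≤ b
ι-cancel-≤ {a} {b} ιa≤ιb rewrite ι≡mkℚ a | ι≡mkℚ b with ιa≤ιb
... | ℚ.*≤* a≤b = subst₂ ℤ._≤_ (ℤP.*-identityʳ a) (ℤP.*-identityʳ b) a≤b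

ι-mono-< : ∀ {a b} → a ℤ.< b → ι a < ι b
ι-mono-< {a} {b} a<b rewrite ι≡mkℚ a | ι≡mkℚ b =
  ℚ.*<* (subst₂ ℤ._<_ (sym (ℤP.*-identityʳ a)) (sym (ℤP.*-identityʳ b)) a<b)

ι-cancel-< : ∀ {a b} → ι a < ι b → a ℤ.< b
ι-cancel-< {a} {b} ιa<ιb rewrite ι≡mkℚ a | ι≡mkℚ b with ιa<ιb
... | ℚ.*<* a<b = subst₂ ℤ._<_ (ℤP.*-identityʳ a) (ℤP.*-identityʳ b) a<b

ι-injective : ∀ {a b} → ι a ≡ ι b → a ≡ b
ι-injective ιa≡ιb = ℤP.≤-antisym (ι-cancel-≤ (ℚP.≤-reflexive ιa≡ιb)) (ι-cancel-≤ (ℚP.≤-reflexive (sym ιa≡ιb)))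

1≤ι : ∀ {k} → 0ℚ < ι k → 1ℚ ≤ ι k
1≤ι {k} 0<ιk = ι-mono-≤ {+ 1} (ℤP.i<j⇒suc[i]≤j (ι-cancel-< {+ 0} {k} 0<ιk))

ℕ-above : ∀ q → ∃ λ F → q < ι (+ F)
ℕ-above (mkℚ -[1+ k ] _ _) = 0 , ℚ.*<* ℤ.-<+
ℕ-above q@(mkℚ (+ k) den _) = suc k , subst (q <_) (sym (ι≡mkℚ (+ suc k)))
  (ℚ.*<* (subst₂ ℤ._<_ (ℤP.pos-* k 1) (ℤP.pos-* (suc k) (suc den)) (ℤ.+<+ k*1<[1+k]*[1+den])))
  where
  k*1<[1+k]*[1+den] : k ℕ.* 1 ℕ.< suc k ℕ.* suc den
  k*1<[1+k]*[1+den] = ℕP.≤-<-trans (ℕP.≤-reflexive (ℕP.*-identityʳ k))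
                        (ℕP.<-≤-trans (ℕP.n<1+n k) (ℕP.m≤m*n (suc k) (suc den)))

ℤ-between : ∀ (E H k : ℤ) → k ℤ.< E ℤ.+ H → E ℤ.< k ℤ.+ + 1 → ∃ λ (lam : ℕ) → k ≡ E ℤ.+ + lam × + lam ℤ.< H
ℤ-between E H k k<E+H E<k+1 = ℤ.∣ k ℤ.- E ∣ , k≡E+[k-E] , k-E<H
  where
  open ℤ-Solver
  E≤k : E ℤ.≤ k
  E≤k = subst (E ℤ.≤_) (solve 1 (λ x → con -[1+ 0 ] :+ (x :+ con (+ 1)) := x) refl k) (ℤP.i<j⇒i≤pred[j] E<k+1)
  ∣k-E∣≡k-E : + ℤ.∣ k ℤ.- E ∣ ≡ k ℤ.- E
  ∣k-E∣≡k-E = ℤP.0≤i⇒+∣i∣≡i (subst (ℤ._≤ k ℤ.- E) (ℤP.+-inverseʳ E) (ℤP.+-monoˡ-≤ (ℤ.- E) E≤k))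
  k≡E+[k-E] : k ≡ E ℤ.+ + ℤ.∣ k ℤ.- E ∣
  k≡E+[k-E] = trans (solve 2 (λ x e → x := e :+ (x :- e)) refl k E) (cong (ℤ._+_ E) (sym ∣k-E∣≡k-E))
  k-E<H : + ℤ.∣ k ℤ.- E ∣ ℤ.< H
  k-E<H = subst₂ ℤ._<_ (sym ∣k-E∣≡k-E) (solve 2 (λ e h → (e :+ h) :- e := h) refl E H) (ℤP.+-monoˡ-< (ℤ.- E) k<E+H)

<ι[1+n]⇒-1<ιn : ∀ {x n} → x < ι (+ suc n) → x - 1ℚ < ι (+ n)
<ι[1+n]⇒-1<ιn {x} {n} x<1+n = subst (x - 1ℚ <_) 1+n-1≡n (ℚP.+-monoˡ-< (- 1ℚ) x<1+n)
  where
  1+n-1≡n : ι (+ suc n) - 1ℚ ≡ ι (+ n)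
  1+n-1≡n = trans (cong (_- 1ℚ) (ι-homo-+ (+ 1) (+ n))) (solve 1 (λ y → con 1ℚ :+ y :- con 1ℚ := y) refl (ι (+ n)))
    where open ℚ-Solver

∑≡sum : ∀ {k} (f : Fin k → ℚ) → ∑ f ≡ ΣQ.sum f
∑≡sum {zero}  f = refl
∑≡sum {suc k} f = cong (_+_ (f zero)) (∑≡sum (f ∘ suc))

∑-cong : ∀ {k} {f g : Fin k → ℚ} → (∀ i → f i ≡ g i) → ∑ f ≡ ∑ g
∑-cong {zero}  f≗g = refl
∑-cong {suc k} f≗g = cong₂ _+_ (f≗g zero) (∑-cong (f≗g ∘ suc))

∑-zero : ∀ {k} {f : Fin k → ℚ} → (∀ i → f i ≡ 0ℚ) → ∑ f ≡ 0ℚ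
∑-zero {zero}  f≗0 = refl
∑-zero {suc k} f≗0 = cong₂ _+_ (f≗0 zero) (∑-zero (f≗0 ∘ suc))

∑-distrib-+ : ∀ {k} (f g : Fin k → ℚ) → ∑ (λ i → f i + g i) ≡ ∑ f + ∑ g
∑-distrib-+ f g = begin
  ∑ (λ i → f i + g i)              ≡⟨ ∑≡sum (λ i → f i + g i) ⟩
  ΣQ.sum (λ i → f i + g i)         ≡⟨ ΣQ.∑-distrib-+ f g ⟩
  ΣQ.sum f + ΣQ.sum g              ≡⟨ sym (cong₂ _+_ (∑≡sum f) (∑≡sum g)) ⟩
  ∑ f + ∑ g                        ∎
  where open ≡-Reasoning

*-distribˡ-∑ : ∀ {k} (c : ℚ) (f : Fin k → ℚ) → c * ∑ f ≡ ∑ (λ i → c * f i)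
*-distribˡ-∑ c f = begin
  c * ∑ f                          ≡⟨ cong (c *_) (∑≡sum f) ⟩
  c * ΣQ.sum f                     ≡⟨ ΣQ.*-distribˡ-sum c f ⟩
  ΣQ.sum (λ i → c * f i)           ≡⟨ sym (∑≡sum (λ i → c * f i)) ⟩
  ∑ (λ i → c * f i)                ∎
  where open ≡-Reasoning

∑-distrib-sub : ∀ {k} (f g : Fin k → ℚ) → ∑ (λ i → f i - g i) ≡ ∑ f - ∑ g
∑-distrib-sub {zero}  f g = refl
∑-distrib-sub {suc k} f g =
  trans (cong (_+_ (f zero - g zero)) (∑-distrib-sub (f ∘ suc) (g ∘ suc)))
        (solve 4 (λ a b c d → (a :- b) :+ (c :- d) := (a :+ c) :- (b :+ d)) refl
               (f zero) (g zero) (∑ (f ∘ suc)) (∑ (g ∘ suc)))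
  where open ℚ-Solver

∑-comm : ∀ {k l} (f : Fin k → Fin l → ℚ) → ∑ (λ i → ∑ (f i)) ≡ ∑ (λ j → ∑ (λ i → f i j))
∑-comm f = begin
  ∑ (λ i → ∑ (f i))                          ≡⟨ ∑∑≡sumsum f ⟩
  ΣQ.sum (λ i → ΣQ.sum (f i))                ≡⟨ ΣQ.∑-comm f ⟩
  ΣQ.sum (λ j → ΣQ.sum (λ i → f i j))        ≡⟨ sym (∑∑≡sumsum (λ j i → f i j)) ⟩
  ∑ (λ j → ∑ (λ i → f i j))                  ∎
  where
  open ≡-Reasoning
  ∑∑≡sumsum : ∀ {k l} (h : Fin k → Fin l → ℚ) → ∑ (λ i → ∑ (h i)) ≡ ΣQ.sum (λ i → ΣQ.sum (h i))
  ∑∑≡sumsum h = trans (∑≡sum (λ i → ∑ (h i))) (ΣQ.sum-cong-≗ (λ i → ∑≡sum (h i)))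

∑-permute : ∀ {k} (f : Fin k → ℚ) (π : Perm.Permutation k k) → ∑ f ≡ ∑ (λ i → f (π Perm.⟨$⟩ʳ i))
∑-permute f π = trans (∑≡sum f) (trans (ΣQ.∑-permute f π) (sym (∑≡sum (λ i → f (π Perm.⟨$⟩ʳ i)))))

∑-single : ∀ {k} (f : Fin k → ℚ) (i : Fin k) → (∀ j → j ≢ i → f j ≡ 0ℚ) → ∑ f ≡ f i
∑-single f zero    f≗0 = trans (cong (_+_ (f zero)) (∑-zero (λ j → f≗0 (suc j) (λ ())))) (ℚP.+-identityʳ _)
∑-single f (suc i) f≗0 =
  trans (cong₂ _+_ (f≗0 zero (λ ())) (∑-single (f ∘ suc) i (λ j j≢i → f≗0 (suc j) (j≢i ∘ FinP.suc-injective))))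
        (ℚP.+-identityˡ _)

∑-mono-≤ : ∀ {k} {f g : Fin k → ℚ} → (∀ i → f i ≤ g i) → ∑ f ≤ ∑ g
∑-mono-≤ {zero}  f≤g = ℚP.≤-refl
∑-mono-≤ {suc k} f≤g = ℚP.+-mono-≤ (f≤g zero) (∑-mono-≤ (f≤g ∘ suc))

∑-nonNeg : ∀ {k} {f : Fin k → ℚ} → (∀ i → 0ℚ ≤ f i) → 0ℚ ≤ ∑ f
∑-nonNeg {k} {f} 0≤f = subst (_≤ ∑ f) (∑-zero {k} (λ _ → refl)) (∑-mono-≤ 0≤f)

term≤∑ : ∀ {k} {f : Fin k → ℚ} → (∀ i → 0ℚ ≤ f i) → ∀ i → f i ≤ ∑ f
term≤∑ {f = f} 0≤f zero    = subst (_≤ ∑ f) (ℚP.+-identityʳ (f zero)) (ℚP.+-monoʳ-≤ (f zero) (∑-nonNeg (0≤f ∘ suc)))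
term≤∑ {f = f} 0≤f (suc i) = ℚP.≤-trans (term≤∑ (0≤f ∘ suc) i)
  (subst (_≤ ∑ f) (ℚP.+-identityˡ _) (ℚP.+-monoˡ-≤ (∑ (f ∘ suc)) (0≤f zero)))

∑-pos⇒∃-pos : ∀ {k} (f : Fin k → ℚ) → 0ℚ < ∑ f → ∃ λ i → 0ℚ < f i
∑-pos⇒∃-pos {zero}  f 0<0 = ⊥-elim (ℚP.<-irrefl refl 0<0)
∑-pos⇒∃-pos {suc k} f 0<∑ with 0ℚ ℚP.<? f zero
... | yes 0<f0 = zero , 0<f0
... | no  0≮f0 with ∑-pos⇒∃-pos (f ∘ suc) (ℚP.≰⇒> λ ∑≤0 → ℚP.<-irrefl refl (ℚP.<-≤-trans 0<∑ (ℚP.+-mono-≤ (ℚP.≮⇒≥ 0≮f0) ∑≤0)))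
...   | i , 0<fi = suc i , 0<fi

ι-∑ℤ : ∀ {k} (f : Fin k → ℤ) → ι (∑ℤ f) ≡ ∑ (ι ∘ f)
ι-∑ℤ {zero}  f = refl
ι-∑ℤ {suc k} f = trans (ι-homo-+ (f zero) _) (cong (_+_ (ι (f zero))) (ι-∑ℤ (f ∘ suc)))

Xvar-diag : ∀ {k} (i : Fin k) → Xvar i i ≡ + 1
Xvar-diag i with i Fin.≟ i
... | yes _   = refl
... | no  i≢i = ⊥-elim (i≢i refl)

Xvar-off : ∀ {k} (i j : Fin k) → i ≢ j → Xvar i j ≡ + 0
Xvar-off i j i≢j with i Fin.≟ j
... | yes i≡j = ⊥-elim (i≢j i≡j)
... | no  _   = refl

Xvar-nonNeg : ∀ {k} (i j : Fin k) → + 0 ℤ.≤ Xvar i j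
Xvar-nonNeg i j with i Fin.≟ j
... | yes _ = ℤ.+≤+ ℕ.z≤n
... | no  _ = ℤ.+≤+ ℕ.z≤n

∑-Xvar-* : ∀ {k} (i : Fin k) (f : Fin k → ℚ) → ∑ (λ j → ι (Xvar i j) * f j) ≡ f i
∑-Xvar-* i f = trans
  (∑-single _ i (λ j j≢i → trans (cong (λ x → ι x * f j) (Xvar-off i j (j≢i ∘ sym))) (ℚP.*-zeroˡ (f j))))
  (trans (cong (λ x → ι x * f i) (Xvar-diag i)) (ℚP.*-identityˡ (f i)))

∑-Xvar : ∀ {k} (i : Fin k) → ∑ (λ j → ι (Xvar i j)) ≡ 1ℚ
∑-Xvar {k} i = trans (∑-cong {k} (λ j → sym (ℚP.*-identityʳ (ι (Xvar i j))))) (∑-Xvar-* i (λ _ → 1ℚ))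

*-pos : ∀ {a b} → 0ℚ < a → 0ℚ < b → 0ℚ < a * b
*-pos {a} {b} 0<a 0<b = ℚP.positive⁻¹ (a * b) {{ℚP.pos*pos⇒pos a {{ℚ.positive 0<a}} b {{ℚ.positive 0<b}}}}

*-nonNeg : ∀ {a b} → 0ℚ ≤ a → 0ℚ ≤ b → 0ℚ ≤ a * b
*-nonNeg {a} {b} 0≤a 0≤b = ℚP.nonNegative⁻¹ (a * b) {{ℚP.nonNeg*nonNeg⇒nonNeg a {{ℚ.nonNegative 0≤a}} b {{ℚ.nonNegative 0≤b}}}}

*-monoʳ-≤ : ∀ {c a b} → 0ℚ ≤ c → a ≤ b → c * a ≤ c * b
*-monoʳ-≤ {c} 0≤c = ℚP.*-monoˡ-≤-nonNeg c {{ℚ.nonNegative 0≤c}}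

*-monoʳ-< : ∀ {c a b} → 0ℚ < c → a < b → c * a < c * b
*-monoʳ-< {c} 0<c = ℚP.*-monoʳ-<-pos c {{ℚ.positive 0<c}}

*-pos⇒pos : ∀ {a b} → 0ℚ ≤ a → 0ℚ < a * b → 0ℚ < a × 0ℚ < b
*-pos⇒pos {a} {b} 0≤a 0<ab = 0<a , 0<b
  where
  0<a : 0ℚ < a
  0<a with 0ℚ ℚP.<? a
  ... | yes 0<a = 0<a
  ... | no  0≮a = ⊥-elim (ℚP.<-irrefl refl (ℚP.<-≤-trans 0<ab
          (ℚP.≤-reflexive (trans (cong (_* b) (ℚP.≤-antisym (ℚP.≮⇒≥ 0≮a) 0≤a)) (ℚP.*-zeroˡ b)))))
  0<b : 0ℚ < b
  0<b with 0ℚ ℚP.<? b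
  ... | yes 0<b = 0<b
  ... | no  0≮b = ⊥-elim (ℚP.<-irrefl refl (ℚP.<-≤-trans 0<ab
          (ℚP.≤-trans (*-monoʳ-≤ 0≤a (ℚP.≮⇒≥ 0≮b)) (ℚP.≤-reflexive (ℚP.*-zeroʳ a)))))

inv-of-pos : ∀ p → 0ℚ < p → inv p * p ≡ 1ℚ × 0ℚ < inv p
inv-of-pos (mkℚ (+ zero) _ _) 0<p with ℚ.positive 0<p
... | ()
inv-of-pos p@(mkℚ (+ suc n) _ _) _ = ℚP.*-inverseˡ p , ℚP.positive⁻¹ (1/ p) {{ℚP.1/pos⇒pos p}}
inv-of-pos (mkℚ -[1+ n ] _ _) 0<p with ℚ.positive 0<p
... | ()

0<x+x⇒0<x : ∀ {x} → 0ℚ < x + x → 0ℚ < x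
0<x+x⇒0<x {x} 0<x+x with 0ℚ ℚP.<? x
... | yes 0<x = 0<x
... | no  0≮x = ⊥-elim (ℚP.<-irrefl refl (ℚP.<-≤-trans 0<x+x (ℚP.+-mono-≤ (ℚP.≮⇒≥ 0≮x) (ℚP.≮⇒≥ 0≮x))))

0<1 : 0ℚ < 1ℚ
0<1 = ι-mono-< {+ 0} {+ 1} (ℤ.+<+ (ℕ.s≤s ℕ.z≤n))

0<2 : 0ℚ < 2ℚ
0<2 = ι-mono-< {+ 0} {+ 2} (ℤ.+<+ (ℕ.s≤s ℕ.z≤n))

p≤∣p∣ : ∀ p → p ≤ ℚ.∣ p ∣
p≤∣p∣ (mkℚ (+ _) _ _)        = ℚP.≤-refl
p≤∣p∣ p@(mkℚ -[1+ _ ] _ _)   = ℚP.≤-trans (ℚ.*≤* ℤ.-≤+) (ℚP.0≤∣p∣ p)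

<1+∑∣∣ : ∀ {k} (v : Fin k → ℚ) a → v a < 1ℚ + ∑ (λ b → ℚ.∣ v b ∣)
<1+∑∣∣ v a = begin-strict
  v a                               ≤⟨ ℚP.≤-trans (p≤∣p∣ (v a)) (term≤∑ (λ b → ℚP.0≤∣p∣ (v b)) a) ⟩
  ∑ (λ b → ℚ.∣ v b ∣)              ≡⟨ sym (ℚP.+-identityˡ _) ⟩
  0ℚ + ∑ (λ b → ℚ.∣ v b ∣)         <⟨ ℚP.+-monoˡ-< (∑ (λ b → ℚ.∣ v b ∣)) 0<1 ⟩
  1ℚ + ∑ (λ b → ℚ.∣ v b ∣)         ∎
  where open ℚP.≤-Reasoning

inv*-unit-interval : ∀ {q M} → 0ℚ < q → q < M → 0ℚ < inv M * q × inv M * q < 1ℚ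
inv*-unit-interval {q} {M} 0<q q<M = *-pos 0<invM 0<q , subst (inv M * q <_) (proj₁ invM) (*-monoʳ-< 0<invM q<M)
  where
  invM : inv M * M ≡ 1ℚ × 0ℚ < inv M
  invM = inv-of-pos M (ℚP.<-trans 0<q q<M)
  0<invM : 0ℚ < inv M
  0<invM = proj₂ invM

*-cancelʳ-pos : ∀ {r x y} → 0ℚ < r → x * r ≡ y * r → x ≡ y
*-cancelʳ-pos {r} 0<r xr≡yr = ℚP.≤-antisym (cancel (ℚP.≤-reflexive xr≡yr)) (cancel (ℚP.≤-reflexive (sym xr≡yr)))
  where
  cancel : ∀ {x y} → x * r ≤ y * r → x ≤ y
  cancel = ℚP.*-cancelʳ-≤-pos r {{ℚ.positive 0<r}}

ι-evalP : ∀ {k} (p : LinPoly k) (z : Fin k → ℤ) → ι (evalP p z) ≡ ∑ (λ j → ι (p j) * ι (z j))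
ι-evalP p z = trans (ι-∑ℤ (λ j → p j ℤ.* z j)) (∑-cong (λ j → ι-homo-* (p j) (z j)))

evalP-≤ : ∀ {k} (p : LinPoly k) (z : Fin k → ℤ) (t : Fin k → ℚ) → (∀ j → + 0 ℤ.≤ p j) →
          (∀ j → ι (z j) ≤ t j) → ι (evalP p z) ≤ ∑ (λ j → ι (p j) * t j)
evalP-≤ p z t 0≤p z≤t = subst (_≤ ∑ (λ j → ι (p j) * t j)) (sym (ι-evalP p z))
  (∑-mono-≤ (λ j → *-monoʳ-≤ (ι-mono-≤ (0≤p j)) (z≤t j)))

≤-evalP+∑ℤ : ∀ {k} (p : LinPoly k) (z : Fin k → ℤ) (t : Fin k → ℚ) → (∀ j → + 0 ℤ.≤ p j) →
             (∀ j → t j ≤ ι (z j ℤ.+ + 1)) → ∑ (λ j → ι (p j) * t j) ≤ ι (evalP p z ℤ.+ ∑ℤ p)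
≤-evalP+∑ℤ p z t 0≤p t≤z+1 = subst (∑ (λ j → ι (p j) * t j) ≤_) ∑≡ι[E+H]
  (∑-mono-≤ (λ j → *-monoʳ-≤ (ι-mono-≤ (0≤p j)) (t≤z+1 j)))
  where
  open ≡-Reasoning
  open ℚ-Solver
  ∑≡ι[E+H] : ∑ (λ j → ι (p j) * ι (z j ℤ.+ + 1)) ≡ ι (evalP p z ℤ.+ ∑ℤ p)
  ∑≡ι[E+H] = begin
    ∑ (λ j → ι (p j) * ι (z j ℤ.+ + 1))         ≡⟨ ∑-cong (λ j → trans (cong (ι (p j) *_) (ι-homo-+ (z j) (+ 1)))
                                                      (ℚP.*-distribˡ-+ (ι (p j)) (ι (z j)) 1ℚ)) ⟩
    ∑ (λ j → ι (p j) * ι (z j) + ι (p j) * 1ℚ)  ≡⟨ ∑-distrib-+ (λ j → ι (p j) * ι (z j)) (λ j → ι (p j) * 1ℚ) ⟩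
    ∑ (λ j → ι (p j) * ι (z j)) + ∑ (λ j → ι (p j) * 1ℚ)
      ≡⟨ cong₂ _+_ (sym (ι-evalP p z)) (trans (∑-cong (λ j → ℚP.*-identityʳ (ι (p j)))) (sym (ι-∑ℤ p))) ⟩
    ι (evalP p z) + ι (∑ℤ p)                    ≡⟨ sym (ι-homo-+ (evalP p z) (∑ℤ p)) ⟩
    ι (evalP p z ℤ.+ ∑ℤ p)                      ∎

module _ {d : ℕ} where
  open ℚ-Solver

  lincomb-cong : ∀ {k} {c c' : Fin k → ℚ} (v : Fin k → Vect d) → (∀ i → c i ≡ c' i) → lincomb c v ≈ lincomb c' v
  lincomb-cong v c≗c' j = ∑-cong (λ i → cong (_* v i j) (c≗c' i))

  lincomb-+ : ∀ {k} (c c' : Fin k → ℚ) (v : Fin k → Vect d) →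
              lincomb (λ i → c i + c' i) v ≈ (lincomb c v +v lincomb c' v)
  lincomb-+ c c' v j = trans (∑-cong (λ i → ℚP.*-distribʳ-+ (v i j) (c i) (c' i))) (∑-distrib-+ (λ i → c i * v i j) (λ i → c' i * v i j))

  lincomb-sub : ∀ {k} (c c' : Fin k → ℚ) (v : Fin k → Vect d) →
              lincomb (λ i → c i - c' i) v ≈ (lincomb c v -v lincomb c' v)
  lincomb-sub c c' v j = trans
    (∑-cong (λ i → solve 3 (λ a b x → (a :- b) :* x := a :* x :- b :* x) refl (c i) (c' i) (v i j)))
    (∑-distrib-sub (λ i → c i * v i j) (λ i → c' i * v i j))

  lincomb-neg : ∀ {k} (c : Fin k → ℚ) (v : Fin k → Vect d) → lincomb (λ i → - c i) v ≈ (-v lincomb c v)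
  lincomb-neg {k} c v j = trans
    (∑-cong (λ i → solve 2 (λ a x → (:- a) :* x := con 0ℚ :- a :* x) refl (c i) (v i j)))
    (trans (∑-distrib-sub {k} (λ _ → 0ℚ) (λ i → c i * v i j))
           (trans (cong (_- lincomb c v j) (∑-zero {k} (λ _ → refl))) (ℚP.+-identityˡ _)))

  lincomb-zero : ∀ {k} {c : Fin k → ℚ} (v : Fin k → Vect d) → (∀ i → c i ≡ 0ℚ) → lincomb c v ≈ 0v
  lincomb-zero v c≗0 j = ∑-zero (λ i → trans (cong (_* v i j) (c≗0 i)) (ℚP.*-zeroˡ (v i j)))

  lincomb-single : ∀ {k} (t : ℚ) (i : Fin k) (v : Fin k → Vect d) →
                   lincomb (λ j → t * ι (Xvar i j)) v ≈ (t • v i)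
  lincomb-single t i v j = begin
    ∑ (λ l → t * ι (Xvar i l) * v l j)       ≡⟨ ∑-cong (λ l → ℚP.*-assoc t (ι (Xvar i l)) (v l j)) ⟩
    ∑ (λ l → t * (ι (Xvar i l) * v l j))     ≡⟨ sym (*-distribˡ-∑ t (λ l → ι (Xvar i l) * v l j)) ⟩
    t * ∑ (λ l → ι (Xvar i l) * v l j)       ≡⟨ cong (t *_) (∑-Xvar-* i (λ l → v l j)) ⟩
    t * v i j                                ∎
    where open ≡-Reasoning

  lincomb-Xvar : ∀ {k} (i : Fin k) (v : Fin k → Vect d) → lincomb (ι ∘ Xvar i) v ≈ v i
  lincomb-Xvar i v j = ∑-Xvar-* i (λ l → v l j)

  lincomb-rescale : ∀ {k} (c r : Fin k → ℚ) (v : Fin k → Vect d) →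
                    lincomb c (λ i → r i • v i) ≈ lincomb (λ i → c i * r i) v
  lincomb-rescale c r v j = ∑-cong (λ i → sym (ℚP.*-assoc (c i) (r i) (v i j)))

  dot : Vect d → Vect d → ℚ
  dot x u = ∑ (λ i → x i * u i)

  dot-•ˡ : ∀ c x u → dot (c • x) u ≡ c * dot x u
  dot-•ˡ c x u = trans (∑-cong (λ i → ℚP.*-assoc c (x i) (u i))) (sym (*-distribˡ-∑ c (λ i → x i * u i)))

  dot-subˡ : ∀ x y u → dot (x -v y) u ≡ dot x u - dot y u
  dot-subˡ x y u = trans
    (∑-cong (λ i → solve 3 (λ a b w → (a :- b) :* w := a :* w :- b :* w) refl (x i) (y i) (u i)))
    (∑-distrib-sub (λ i → x i * u i) (λ i → y i * u i))

  dot-lincombˡ : ∀ {k} (c : Fin k → ℚ) (v : Fin k → Vect d) u →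
                 dot (lincomb c v) u ≡ ∑ (λ l → c l * dot (v l) u)
  dot-lincombˡ {k} c v u = begin
    ∑ (λ i → ∑ (λ l → c l * v l i) * u i)      ≡⟨ ∑-cong (λ i → ℚP.*-comm _ (u i)) ⟩
    ∑ (λ i → u i * ∑ (λ l → c l * v l i))      ≡⟨ ∑-cong (λ i → *-distribˡ-∑ (u i) (λ l → c l * v l i)) ⟩
    ∑ (λ i → ∑ (λ l → u i * (c l * v l i)))    ≡⟨ ∑-comm (λ i l → u i * (c l * v l i)) ⟩
    ∑ (λ l → ∑ (λ i → u i * (c l * v l i)))    ≡⟨ ∑-cong (λ l → ∑-cong (λ i →
                                                    solve 3 (λ w a b → w :* (a :* b) := a :* (b :* w)) refl (u i) (c l) (v l i))) ⟩
    ∑ (λ l → ∑ (λ i → c l * (v l i * u i)))    ≡⟨ ∑-cong (λ l → sym (*-distribˡ-∑ (c l) (λ i → v l i * u i))) ⟩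
    ∑ (λ l → c l * dot (v l) u)                ∎
    where open ≡-Reasoning

module SymmetricForm {d : ℕ} (B : Gram d) (B-sym : ∀ i j → B i j ≡ B j i) where

  ⟪_,_⟫ : Vect d → Vect d → ℚ
  ⟪ x , y ⟫ = ⟨ B ∣ x , y ⟩

  B· : Vect d → Vect d
  B· y i = ∑ (λ j → B i j * y j)

  ⟪⟫≡dot : ∀ x y → ⟪ x , y ⟫ ≡ dot x (B· y)
  ⟪⟫≡dot x y = ∑-cong (λ i → trans (∑-cong (λ j → ℚP.*-assoc (x i) (B i j) (y j)))
                                    (sym (*-distribˡ-∑ (x i) (λ j → B i j * y j))))

  ⟪⟫-cong : ∀ {x x' y y'} → x ≈ x' → y ≈ y' → ⟪ x , y ⟫ ≡ ⟪ x' , y' ⟫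
  ⟪⟫-cong x≈x' y≈y' = ∑-cong (λ i → ∑-cong (λ j → cong₂ (λ a b → a * B i j * b) (x≈x' i) (y≈y' j)))

  ⟪⟫-sym : ∀ x y → ⟪ x , y ⟫ ≡ ⟪ y , x ⟫
  ⟪⟫-sym x y = trans (∑-comm (λ i j → x i * B i j * y j)) (∑-cong (λ j → ∑-cong (λ i →
    trans (cong (λ b → x i * b * y j) (B-sym i j))
          (solve 3 (λ a b c → a :* b :* c := c :* b :* a) refl (x i) (B j i) (y j)))))
    where open ℚ-Solver

  ⟪⟫-•ˡ : ∀ c x y → ⟪ c • x , y ⟫ ≡ c * ⟪ x , y ⟫
  ⟪⟫-•ˡ c x y = trans (⟪⟫≡dot (c • x) y) (trans (dot-•ˡ c x (B· y)) (cong (c *_) (sym (⟪⟫≡dot x y))))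

  ⟪⟫-subˡ : ∀ x x' y → ⟪ x -v x' , y ⟫ ≡ ⟪ x , y ⟫ - ⟪ x' , y ⟫
  ⟪⟫-subˡ x x' y = trans (⟪⟫≡dot (x -v x') y)
    (trans (dot-subˡ x x' (B· y)) (sym (cong₂ _-_ (⟪⟫≡dot x y) (⟪⟫≡dot x' y))))

  ⟪⟫-lincombˡ : ∀ {k} (c : Fin k → ℚ) (v : Fin k → Vect d) y →
                ⟪ lincomb c v , y ⟫ ≡ ∑ (λ l → c l * ⟪ v l , y ⟫)
  ⟪⟫-lincombˡ c v y = trans (⟪⟫≡dot (lincomb c v) y)
    (trans (dot-lincombˡ c v (B· y)) (∑-cong (λ l → cong (c l *_) (sym (⟪⟫≡dot (v l) y)))))

  ⟪⟫-•ʳ : ∀ c x y → ⟪ x , c • y ⟫ ≡ c * ⟪ x , y ⟫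
  ⟪⟫-•ʳ c x y = trans (⟪⟫-sym x (c • y)) (trans (⟪⟫-•ˡ c y x) (cong (c *_) (⟪⟫-sym y x)))

  ⟪⟫-subʳ : ∀ x y y' → ⟪ x , y -v y' ⟫ ≡ ⟪ x , y ⟫ - ⟪ x , y' ⟫
  ⟪⟫-subʳ x y y' = trans (⟪⟫-sym x (y -v y'))
    (trans (⟪⟫-subˡ y y' x) (cong₂ _-_ (⟪⟫-sym y x) (⟪⟫-sym y' x)))

  ⟪⟫-lincombʳ : ∀ {k} (c : Fin k → ℚ) (v : Fin k → Vect d) x →
                ⟪ x , lincomb c v ⟫ ≡ ∑ (λ l → c l * ⟪ x , v l ⟫)
  ⟪⟫-lincombʳ c v x = trans (⟪⟫-sym x (lincomb c v))
    (trans (⟪⟫-lincombˡ c v x) (∑-cong (λ l → cong (c l *_) (⟪⟫-sym (v l) x))))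

  ∥_∥² : Vect d → ℚ
  ∥ x ∥² = ⟪ x , x ⟫

  corootFactor : Vect d → ℚ
  corootFactor a = 2ℚ * inv ∥ a ∥²

  -- Written as in sRefl with k = 0, so that sRefl B a (+ 0) x j unfolds to x j - cartan a x * a j.
  cartan : Vect d → Vect d → ℚ
  cartan a x = 2ℚ * ⟪ a , x ⟫ * inv ∥ a ∥² - ι (+ 0)

  reflect : Vect d → Vect d → Vect d
  reflect a = sRefl B a (+ 0)

  corootFactor-pos : ∀ a → 0ℚ < ∥ a ∥² → 0ℚ < corootFactor a
  corootFactor-pos a 0<∥a∥² = *-pos 0<2 (proj₂ (inv-of-pos ∥ a ∥² 0<∥a∥²))

  ⟪⟫-coroot : ∀ x a → ⟪ x , coroot B a ⟫ ≡ corootFactor a * ⟪ x , a ⟫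
  ⟪⟫-coroot x a = ⟪⟫-•ʳ (corootFactor a) x a

  cartan≡factor* : ∀ a x → cartan a x ≡ corootFactor a * ⟪ a , x ⟫
  cartan≡factor* a x = trans (ℚP.+-identityʳ _)
    (solve 3 (λ t g i → t :* g :* i := t :* i :* g) refl 2ℚ ⟪ a , x ⟫ (inv ∥ a ∥²))
    where open ℚ-Solver

  cartan≡⟪⟫-coroot : ∀ a x → cartan a x ≡ ⟪ x , coroot B a ⟫
  cartan≡⟪⟫-coroot a x = trans (cartan≡factor* a x)
    (trans (cong (corootFactor a *_) (⟪⟫-sym a x)) (sym (⟪⟫-coroot x a)))

  module _ (a : Vect d) (0<∥a∥² : 0ℚ < ∥ a ∥²) where
    open ℚ-Solver
    open ≡-Reasoning

    cartan*∥∥² : ∀ x → cartan a x * ∥ a ∥² ≡ 2ℚ * ⟪ a , x ⟫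
    cartan*∥∥² x = begin
      cartan a x * ∥ a ∥²                       ≡⟨ cong (_* ∥ a ∥²) (cartan≡factor* a x) ⟩
      2ℚ * inv ∥ a ∥² * ⟪ a , x ⟫ * ∥ a ∥²
        ≡⟨ solve 4 (λ t i g n → t :* i :* g :* n := t :* g :* (i :* n)) refl 2ℚ (inv ∥ a ∥²) ⟪ a , x ⟫ ∥ a ∥² ⟩
      2ℚ * ⟪ a , x ⟫ * (inv ∥ a ∥² * ∥ a ∥²)   ≡⟨ cong (2ℚ * ⟪ a , x ⟫ *_) (proj₁ (inv-of-pos ∥ a ∥² 0<∥a∥²)) ⟩
      2ℚ * ⟪ a , x ⟫ * 1ℚ                       ≡⟨ ℚP.*-identityʳ _ ⟩
      2ℚ * ⟪ a , x ⟫                            ∎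

    cartan-pos : ∀ {x} → 0ℚ < ⟪ a , x ⟫ → 0ℚ < cartan a x
    cartan-pos {x} 0<⟪a,x⟫ = subst (0ℚ <_) (sym (cartan≡factor* a x)) (*-pos (corootFactor-pos a 0<∥a∥²) 0<⟪a,x⟫)

    cartan-neg : ∀ {x} → ⟪ a , x ⟫ < 0ℚ → cartan a x < 0ℚ
    cartan-neg {x} ⟪a,x⟫<0 = subst₂ _<_ (sym (cartan≡factor* a x)) (ℚP.*-zeroʳ (corootFactor a))
                                      (*-monoʳ-< (corootFactor-pos a 0<∥a∥²) ⟪a,x⟫<0)

    cartan-self : cartan a a ≡ 2ℚ
    cartan-self = *-cancelʳ-pos 0<∥a∥² (cartan*∥∥² a)

    ⟪reflect⟫ˡ : ∀ x y → ⟪ reflect a x , y ⟫ ≡ ⟪ x , y ⟫ - cartan a x * ⟪ a , y ⟫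
    ⟪reflect⟫ˡ x y = trans (⟪⟫-subˡ x (cartan a x • a) y) (cong (_-_ ⟪ x , y ⟫) (⟪⟫-•ˡ (cartan a x) a y))

    ⟪reflect⟫ʳ : ∀ x y → ⟪ y , reflect a x ⟫ ≡ ⟪ y , x ⟫ - cartan a x * ⟪ y , a ⟫
    ⟪reflect⟫ʳ x y = trans (⟪⟫-subʳ y x (cartan a x • a)) (cong (_-_ ⟪ y , x ⟫) (⟪⟫-•ʳ (cartan a x) y a))

    ⟪a,reflect⟫ : ∀ x → ⟪ a , reflect a x ⟫ ≡ - ⟪ a , x ⟫
    ⟪a,reflect⟫ x = begin
      ⟪ a , reflect a x ⟫                      ≡⟨ ⟪reflect⟫ʳ x a ⟩
      ⟪ a , x ⟫ - cartan a x * ∥ a ∥²          ≡⟨ cong (_-_ ⟪ a , x ⟫) (cartan*∥∥² x) ⟩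
      ⟪ a , x ⟫ - 2ℚ * ⟪ a , x ⟫               ≡⟨ solve 1 (λ g → g :- con 2ℚ :* g := :- g) refl ⟪ a , x ⟫ ⟩
      - ⟪ a , x ⟫                              ∎

    cartan-reflect : ∀ x → cartan a (reflect a x) ≡ - cartan a x
    cartan-reflect x = begin
      cartan a (reflect a x)                   ≡⟨ cartan≡factor* a (reflect a x) ⟩
      corootFactor a * ⟪ a , reflect a x ⟫     ≡⟨ cong (corootFactor a *_) (⟪a,reflect⟫ x) ⟩
      corootFactor a * - ⟪ a , x ⟫             ≡⟨ sym (ℚP.neg-distribʳ-* (corootFactor a) ⟪ a , x ⟫) ⟩
      - (corootFactor a * ⟪ a , x ⟫)           ≡⟨ cong -_ (sym (cartan≡factor* a x)) ⟩
      - cartan a x                             ∎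

    reflect-involutive : ∀ x → reflect a (reflect a x) ≈ x
    reflect-involutive x j = begin
      (x j - cartan a x * a j) - cartan a (reflect a x) * a j    ≡⟨ cong (λ t → (x j - cartan a x * a j) - t * a j) (cartan-reflect x) ⟩
      (x j - cartan a x * a j) - (- cartan a x) * a j
        ≡⟨ solve 3 (λ y k u → (y :- k :* u) :- (:- k) :* u := y) refl (x j) (cartan a x) (a j) ⟩
      x j                                                        ∎

    ∥reflect∥² : ∀ x → ∥ reflect a x ∥² ≡ ∥ x ∥²
    ∥reflect∥² x = begin
      ⟪ reflect a x , reflect a x ⟫                              ≡⟨ ⟪reflect⟫ˡ x (reflect a x) ⟩
      ⟪ x , reflect a x ⟫ - cartan a x * ⟪ a , reflect a x ⟫     ≡⟨ cong₂ (λ u v → u - cartan a x * v) (⟪reflect⟫ʳ x x) (⟪a,reflect⟫ x) ⟩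
      (∥ x ∥² - cartan a x * ⟪ x , a ⟫) - cartan a x * - ⟪ a , x ⟫
        ≡⟨ cong (λ g → (∥ x ∥² - cartan a x * g) - cartan a x * - ⟪ a , x ⟫) (⟪⟫-sym x a) ⟩
      (∥ x ∥² - cartan a x * ⟪ a , x ⟫) - cartan a x * - ⟪ a , x ⟫
        ≡⟨ solve 3 (λ n k g → (n :- k :* g) :- k :* (:- g) := n) refl ∥ x ∥² (cartan a x) ⟪ a , x ⟫ ⟩
      ∥ x ∥²                                                     ∎

    coroot-reflect : ∀ x → coroot B (reflect a x) ≈ (coroot B x -v (⟪ a , coroot B x ⟫ • coroot B a))
    coroot-reflect x j = begin
      corootFactor (reflect a x) * (x j - cartan a x * a j)
        ≡⟨ cong (λ n → 2ℚ * inv n * (x j - cartan a x * a j)) (∥reflect∥² x) ⟩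
      corootFactor x * (x j - cartan a x * a j)
        ≡⟨ cong (λ k → corootFactor x * (x j - k * a j)) (cartan≡factor* a x) ⟩
      corootFactor x * (x j - corootFactor a * ⟪ a , x ⟫ * a j)
        ≡⟨ solve 5 (λ p q g t u → p :* (t :- q :* g :* u) := p :* t :- (p :* g) :* (q :* u)) refl
                   (corootFactor x) (corootFactor a) ⟪ a , x ⟫ (x j) (a j) ⟩
      corootFactor x * x j - (corootFactor x * ⟪ a , x ⟫) * (corootFactor a * a j)
        ≡⟨ cong (λ g → corootFactor x * x j - g * (corootFactor a * a j)) (sym (⟪⟫-coroot a x)) ⟩
      corootFactor x * x j - ⟪ a , coroot B x ⟫ * (corootFactor a * a j)  ∎

  reflect-cong : ∀ a {x y} → x ≈ y → reflect a x ≈ reflect a y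
  reflect-cong a x≈y j = cong₂ (λ u g → u - (2ℚ * g * inv ∥ a ∥² - ι (+ 0)) * a j) (x≈y j) (⟪⟫-cong {a} {a} (λ _ → refl) x≈y)

  coroot-cong : ∀ {x y} → x ≈ y → coroot B x ≈ coroot B y
  coroot-cong x≈y j = cong₂ (λ n u → 2ℚ * inv n * u) (⟪⟫-cong x≈y x≈y) (x≈y j)

module RootSystem
  {d m n : ℕ} (B : Gram d) (Φ : Fin m → Vect d) (Δ : Fin n → Fin m)
  (B-sym : ∀ i j → B i j ≡ B j i)
  (B-posDef : ∀ x → ¬ (x ≈ 0v) → 0ℚ < ⟨ B ∣ x , x ⟩)
  (Φ-injective : ∀ a b → Φ a ≈ Φ b → a ≡ b)
  (Φ≉0 : ∀ a → ¬ (Φ a ≈ 0v))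
  (Φ-multiples : ∀ a c → InΦ B Φ (c • Φ a) → c ≡ 1ℚ ⊎ c ≡ - 1ℚ)
  (Φ-reflect : ∀ a b → InΦ B Φ (sRefl B (Φ a) (+ 0) (Φ b)))
  (Φ-crystallographic : ∀ a b → ∃ λ k → ⟨ B ∣ Φ b , coroot B (Φ a) ⟩ ≡ ι k)
  (Δ-independent : ∀ c → lincomb c (simple B Φ Δ) ≈ 0v → ∀ i → c i ≡ 0ℚ)
  (Δ-sign : ∀ a → NonnegComb B Φ Δ (Φ a) ⊎ NonnegComb B Φ Δ (-v Φ a))
  where

  open SymmetricForm B B-sym
  open ℚ-Solver

  α : Fin n → Vect d
  α = simple B Φ Δ

  α∨ : Fin n → Vect d
  α∨ i = coroot B (α i)

  Pos : Fin m → Set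
  Pos = Positive B Φ Δ

  Neg : Fin m → Set
  Neg a = NonnegComb B Φ Δ (-v Φ a)

  0<∥Φ∥² : ∀ a → 0ℚ < ∥ Φ a ∥²
  0<∥Φ∥² a = B-posDef (Φ a) (Φ≉0 a)

  coords-unique : ∀ c c' → lincomb c α ≈ lincomb c' α → ∀ i → c i ≡ c' i
  coords-unique c c' c≈c' i = x∙y⁻¹≈ε⇒x≈y (c i) (c' i) (Δ-independent (λ j → c j - c' j) diff≈0 i)
    where
    diff≈0 : lincomb (λ j → c j - c' j) α ≈ 0v
    diff≈0 k = trans (lincomb-sub c c' α k) (trans (cong (_- lincomb c' α k) (c≈c' k)) (ℚP.+-inverseʳ (lincomb c' α k)))

  pos-coords-nonNeg : ∀ {b} c → Pos b → Φ b ≈ lincomb c α → ∀ j → 0ℚ ≤ c j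
  pos-coords-nonNeg c (c⁺ , 0≤c⁺ , b≈c⁺) b≈c j =
    subst (0ℚ ≤_) (coords-unique c⁺ c (λ k → trans (sym (b≈c⁺ k)) (b≈c k)) j) (0≤c⁺ j)

  neg-coords : ∀ {b} c → (-v Φ b) ≈ lincomb c α → Φ b ≈ lincomb (λ i → - c i) α
  neg-coords {b} c -b≈c k = trans (sym (⁻¹-involutive (Φ b k))) (trans (cong -_ (-b≈c k)) (sym (lincomb-neg c α k)))

  neg-coords-nonPos : ∀ {b} c → Neg b → Φ b ≈ lincomb c α → ∀ j → c j ≤ 0ℚ
  neg-coords-nonPos c (c⁻ , 0≤c⁻ , -b≈c⁻) b≈c j =
    subst (_≤ 0ℚ) (coords-unique (λ i → - c⁻ i) c (λ k → trans (sym (neg-coords c⁻ -b≈c⁻ k)) (b≈c k)) j)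
          (ℚP.neg-antimono-≤ (0≤c⁻ j))

  ¬pos×neg : ∀ b → Pos b → Neg b → ⊥
  ¬pos×neg b (c , 0≤c , b≈c) b⁻ = Φ≉0 b (λ k → trans (b≈c k) (lincomb-zero α c≡0 k))
    where
    c≡0 : ∀ j → c j ≡ 0ℚ
    c≡0 j = ℚP.≤-antisym (neg-coords-nonPos c b⁻ b≈c j) (0≤c j)

  pos-if-coord-pos : ∀ {b} c → Φ b ≈ lincomb c α → ∀ j → 0ℚ < c j → Pos b
  pos-if-coord-pos {b} c b≈c j 0<cj with Δ-sign b
  ... | inj₁ b⁺ = b⁺
  ... | inj₂ b⁻ = ⊥-elim (ℚP.<-irrefl refl (ℚP.<-≤-trans 0<cj (neg-coords-nonPos c b⁻ b≈c j)))

  neg-if-coord-neg : ∀ {b} c → Φ b ≈ lincomb c α → ∀ j → c j < 0ℚ → Neg b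
  neg-if-coord-neg {b} c b≈c j cj<0 with Δ-sign b
  ... | inj₂ b⁻ = b⁻
  ... | inj₁ b⁺ = ⊥-elim (ℚP.<-irrefl refl (ℚP.<-≤-trans cj<0 (pos-coords-nonNeg c b⁺ b≈c j)))

  simple-coords : ∀ i → α i ≈ lincomb (ι ∘ Xvar i) α
  simple-coords i k = sym (lincomb-Xvar i α k)

  simple-pos : ∀ i → Pos (Δ i)
  simple-pos i = ι ∘ Xvar i , (λ j → ι-mono-≤ (Xvar-nonNeg i j)) , simple-coords i

  Δ-injective : ∀ {i i'} → Δ i ≡ Δ i' → i ≡ i'
  Δ-injective {i} {i'} Δi≡Δi' with i Fin.≟ i'
  ... | yes i≡i' = i≡i'
  ... | no  i≢i' = ⊥-elim (ℚP.<-irrefl 0≡1 0<1)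
    where
    0≡1 : 0ℚ ≡ 1ℚ
    0≡1 = sym (trans (cong ι (sym (Xvar-diag i)))
      (trans (coords-unique (ι ∘ Xvar i) (ι ∘ Xvar i') (λ k → trans (sym (simple-coords i k))
                (trans (cong (λ a → Φ a k) Δi≡Δi') (simple-coords i' k))) i)
             (cong ι (Xvar-off i' i (i≢i' ∘ sym)))))

  module SimpleReflection (i : Fin n) where

    σ : Fin m → Fin m
    σ a = proj₁ (Φ-reflect (Δ i) a)

    Φ∘σ : ∀ a → Φ (σ a) ≈ reflect (α i) (Φ a)
    Φ∘σ a = proj₂ (Φ-reflect (Δ i) a)

    σ-involutive : ∀ a → σ (σ a) ≡ a
    σ-involutive a = Φ-injective (σ (σ a)) a (λ k →
      trans (Φ∘σ (σ a) k) (trans (reflect-cong (α i) (Φ∘σ a) k) (reflect-involutive (α i) (0<∥Φ∥² (Δ i)) (Φ a) k)))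

    σ-permutation : Perm.Permutation m m
    σ-permutation = Perm.permutation σ σ σ-involutive σ-involutive

    shift-at-i : ℚ → (Fin n → ℚ) → Fin n → ℚ
    shift-at-i t c j = c j - t * ι (Xvar i j)

    σ-coords : ∀ {a} c → Φ a ≈ lincomb c α → Φ (σ a) ≈ lincomb (shift-at-i (cartan (α i) (Φ a)) c) α
    σ-coords {a} c a≈c k = begin
      Φ (σ a) k                                             ≡⟨ Φ∘σ a k ⟩
      Φ a k - K * α i k                                     ≡⟨ cong₂ _-_ (a≈c k) (sym (lincomb-single K i α k)) ⟩
      lincomb c α k - lincomb (λ j → K * ι (Xvar i j)) α k  ≡⟨ sym (lincomb-sub c (λ j → K * ι (Xvar i j)) α k) ⟩
      lincomb (shift-at-i K c) α k                          ∎
      where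
      open ≡-Reasoning
      K : ℚ
      K = cartan (α i) (Φ a)

    shift-at-i-at-i : ∀ t (c : Fin n → ℚ) → shift-at-i t c i ≡ c i - t
    shift-at-i-at-i t c = trans (cong (λ x → c i - t * ι x) (Xvar-diag i)) (cong (_-_ (c i)) (ℚP.*-identityʳ t))

    shift-at-i-off-i : ∀ t (c : Fin n → ℚ) j → i ≢ j → shift-at-i t c j ≡ c j
    shift-at-i-off-i t c j i≢j = trans (cong (λ x → c j - t * ι x) (Xvar-off i j i≢j))
                                   (trans (cong (_-_ (c j)) (ℚP.*-zeroʳ t)) (ℚP.+-identityʳ (c j)))

  IntCorootCoords : Fin m → Set
  IntCorootCoords a = Σ (Fin n → ℤ) λ e → (∀ j → + 0 ℤ.≤ e j) × (coroot B (Φ a) ≈ lincomb (ι ∘ e) α∨)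

  -- From 0 < ∥θ∥² = ∑ⱼ cⱼ ⟪θ , αⱼ⟫.
  simple-with-positive-pairing : ∀ {a} c → (∀ j → 0ℚ ≤ c j) → Φ a ≈ lincomb c α →
                                 ∃ λ j → 0ℚ < c j × 0ℚ < ⟪ α j , Φ a ⟫
  simple-with-positive-pairing {a} c 0≤c a≈c =
    j , proj₁ 0<cj×0<g , subst (0ℚ <_) (⟪⟫-sym (Φ a) (α j)) (proj₂ 0<cj×0<g)
    where
    ∥a∥²≡∑ : ∥ Φ a ∥² ≡ ∑ (λ l → c l * ⟪ Φ a , α l ⟫)
    ∥a∥²≡∑ = trans (⟪⟫-cong {Φ a} {Φ a} {Φ a} {lincomb c α} (λ _ → refl) a≈c) (⟪⟫-lincombʳ c α (Φ a))
    positive-summand : ∃ λ l → 0ℚ < c l * ⟪ Φ a , α l ⟫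
    positive-summand = ∑-pos⇒∃-pos (λ l → c l * ⟪ Φ a , α l ⟫) (subst (0ℚ <_) ∥a∥²≡∑ (0<∥Φ∥² a))
    j : Fin n
    j = proj₁ positive-summand
    0<cj×0<g : 0ℚ < c j × 0ℚ < ⟪ Φ a , α j ⟫
    0<cj×0<g = *-pos⇒pos (0≤c j) (proj₂ positive-summand)

  root-on-one-simple : ∀ {a} c j → (∀ l → 0ℚ ≤ c l) → Φ a ≈ lincomb c α → 0ℚ < c j →
                       ¬ (∃ λ l → l ≢ j × 0ℚ < c l) → Φ a ≈ α j
  root-on-one-simple {a} c j 0≤c a≈c 0<cj ∄l k = trans (a≈cj•αj k) (trans (cong (_* α j k) cj≡1) (ℚP.*-identityˡ (α j k)))
    where
    c≡0 : ∀ l → l ≢ j → c l ≡ 0ℚ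
    c≡0 l l≢j = ℚP.≤-antisym (ℚP.≮⇒≥ (λ 0<cl → ∄l (l , l≢j , 0<cl))) (0≤c l)
    a≈cj•αj : Φ a ≈ (c j • α j)
    a≈cj•αj k = trans (a≈c k) (∑-single (λ l → c l * α l k) j (λ l l≢j → trans (cong (_* α l k) (c≡0 l l≢j)) (ℚP.*-zeroˡ (α l k))))
    cj≡1 : c j ≡ 1ℚ
    cj≡1 = [ id , (λ cj≡-1 → ⊥-elim (ℚP.<-asym 0<cj (subst (_< 0ℚ) (sym cj≡-1) (ℚ.*<* ℤ.-<+)))) ]′
             (Φ-multiples (Δ j) (c j) (a , a≈cj•αj))

  module _ {a : Fin m} (j : Fin n) (0<⟪αj,a⟫ : 0ℚ < ⟪ α j , Φ a ⟫) where
    open SimpleReflection j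

    -- cartan (α j) θ = ⟪ θ , αⱼ∨ ⟫ is a positive integer.
    1≤cartan : 1ℚ ≤ cartan (α j) (Φ a)
    1≤cartan = subst (1ℚ ≤_) (sym K≡k) (1≤ι {k} (subst (0ℚ <_) K≡k (cartan-pos (α j) (0<∥Φ∥² (Δ j)) 0<⟪αj,a⟫)))
      where
      k : ℤ
      k = proj₁ (Φ-crystallographic (Δ j) a)
      K≡k : cartan (α j) (Φ a) ≡ ι k
      K≡k = trans (cartan≡⟪⟫-coroot (α j) (Φ a)) (proj₂ (Φ-crystallographic (Δ j) a))

    -- The coroot relation θ∨ = (s_j θ)∨ + ⟪αⱼ , θ∨⟫ αⱼ∨, where ⟪αⱼ , θ∨⟫ is a nonnegative integer.
    coroot-coords-from-reflection : IntCorootCoords (σ a) → IntCorootCoords a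
    coroot-coords-from-reflection (e' , 0≤e' , σa∨≈e') = e , 0≤e , a∨≈e
      where
      θ∨ : Vect d
      θ∨ = coroot B (Φ a)
      k : ℤ
      k = proj₁ (Φ-crystallographic a (Δ j))
      ⟪αj,θ∨⟫≡k : ⟪ α j , θ∨ ⟫ ≡ ι k
      ⟪αj,θ∨⟫≡k = proj₂ (Φ-crystallographic a (Δ j))
      0≤k : + 0 ℤ.≤ k
      0≤k = ℤP.<⇒≤ (ι-cancel-< {+ 0} (subst (0ℚ <_) ⟪αj,θ∨⟫≡k
              (subst (0ℚ <_) (sym (⟪⟫-coroot (α j) (Φ a))) (*-pos (corootFactor-pos (Φ a) (0<∥Φ∥² a)) 0<⟪αj,a⟫))))
      e : Fin n → ℤ
      e i = e' i ℤ.+ k ℤ.* Xvar j i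
      0≤e : ∀ i → + 0 ℤ.≤ e i
      0≤e i = ℤP.+-mono-≤ (0≤e' i) (ℤP.≤-trans (ℤP.≤-reflexive (sym (ℤP.*-zeroʳ k)))
                                      (ℤP.*-monoˡ-≤-nonNeg k {{ℤ.nonNegative 0≤k}} (Xvar-nonNeg j i)))
      σa∨≈ : coroot B (Φ (σ a)) ≈ (θ∨ -v (⟪ α j , θ∨ ⟫ • α∨ j))
      σa∨≈ t = trans (coroot-cong (Φ∘σ a) t) (coroot-reflect (α j) (0<∥Φ∥² (Δ j)) (Φ a) t)
      a∨≈e : θ∨ ≈ lincomb (ι ∘ e) α∨
      a∨≈e t = sym (begin
        lincomb (ι ∘ e) α∨ t
          ≡⟨ lincomb-cong α∨ (λ i → trans (ι-homo-+ (e' i) _) (cong (_+_ (ι (e' i))) (ι-homo-* k (Xvar j i)))) t ⟩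
        lincomb (λ i → ι (e' i) + ι k * ι (Xvar j i)) α∨ t
          ≡⟨ lincomb-+ (ι ∘ e') (λ i → ι k * ι (Xvar j i)) α∨ t ⟩
        lincomb (ι ∘ e') α∨ t + lincomb (λ i → ι k * ι (Xvar j i)) α∨ t
          ≡⟨ cong₂ _+_ (sym (σa∨≈e' t)) (lincomb-single (ι k) j α∨ t) ⟩
        coroot B (Φ (σ a)) t + ι k * α∨ j t
          ≡⟨ cong₂ (λ u v → u + v * α∨ j t) (σa∨≈ t) (sym ⟪αj,θ∨⟫≡k) ⟩
        (θ∨ t - ⟪ α j , θ∨ ⟫ * α∨ j t) + ⟪ α j , θ∨ ⟫ * α∨ j t
          ≡⟨ solve 2 (λ x y → (x :- y) :+ y := x) refl (θ∨ t) (⟪ α j , θ∨ ⟫ * α∨ j t) ⟩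
        θ∨ t ∎)
        where open ≡-Reasoning

    reflection-lowers-height : ∀ c → (∀ i → 0ℚ ≤ c i) → Φ a ≈ lincomb c α → ∀ l → l ≢ j → 0ℚ < c l →
                               ∃ λ c' → (∀ i → 0ℚ ≤ c' i) × Φ (σ a) ≈ lincomb c' α × ∑ c' ≤ ∑ c - 1ℚ
    reflection-lowers-height c 0≤c a≈c l l≢j 0<cl = c' , pos-coords-nonNeg c' σa⁺ σa≈c' , σa≈c' , ∑c'≤∑c-1
      where
      K : ℚ
      K = cartan (α j) (Φ a)
      c' : Fin n → ℚ
      c' = shift-at-i K c
      σa≈c' : Φ (σ a) ≈ lincomb c' α
      σa≈c' = σ-coords c a≈c
      σa⁺ : Pos (σ a)
      σa⁺ = pos-if-coord-pos c' σa≈c' l (subst (0ℚ <_) (sym (shift-at-i-off-i K c l (l≢j ∘ sym))) 0<cl)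
      ∑c'≡∑c-K : ∑ c' ≡ ∑ c - K
      ∑c'≡∑c-K = trans (∑-distrib-sub c (λ i → K * ι (Xvar j i)))
        (cong (_-_ (∑ c)) (trans (sym (*-distribˡ-∑ K (ι ∘ Xvar j))) (trans (cong (K *_) (∑-Xvar j)) (ℚP.*-identityʳ K))))
      ∑c'≤∑c-1 : ∑ c' ≤ ∑ c - 1ℚ
      ∑c'≤∑c-1 = subst (_≤ ∑ c - 1ℚ) (sym ∑c'≡∑c-K)
        (ℚP.+-monoʳ-≤ (∑ c) (ℚP.neg-antimono-≤ 1≤cartan))

  coroot-coords-by-height : ∀ F {a} c → (∀ j → 0ℚ ≤ c j) → Φ a ≈ lincomb c α → ∑ c < ι (+ F) → IntCorootCoords a
  coroot-coords-by-height zero c 0≤c _ ∑c<0 = ⊥-elim (ℚP.<-irrefl refl (ℚP.≤-<-trans (∑-nonNeg 0≤c) ∑c<0))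
  coroot-coords-by-height (suc F) {a} c 0≤c a≈c ∑c<1+F = descend (simple-with-positive-pairing c 0≤c a≈c)
    where
    descend : (∃ λ j → 0ℚ < c j × 0ℚ < ⟪ α j , Φ a ⟫) → IntCorootCoords a
    descend (j , 0<cj , 0<⟪αj,a⟫) = case FinP.any? (λ l → ¬? (l Fin.≟ j) ×-dec (0ℚ ℚP.<? c l)) of λ where
      (no ∄l) → Xvar j , Xvar-nonNeg j ,
        λ t → trans (coroot-cong (root-on-one-simple c j 0≤c a≈c 0<cj ∄l) t) (sym (lincomb-Xvar j α∨ t))
      (yes (l , l≢j , 0<cl)) →
        let c' , 0≤c' , σa≈c' , ∑c'≤∑c-1 = reflection-lowers-height j 0<⟪αj,a⟫ c 0≤c a≈c l l≢j 0<cl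
        in coroot-coords-from-reflection j 0<⟪αj,a⟫
             (coroot-coords-by-height F c' 0≤c' σa≈c' (ℚP.≤-<-trans ∑c'≤∑c-1 (<ι[1+n]⇒-1<ιn {∑ c} {F} ∑c<1+F)))

  int-coroot-coords : ∀ a → Pos a → IntCorootCoords a
  int-coroot-coords a (c , 0≤c , a≈c) = coroot-coords-by-height (proj₁ (ℕ-above (∑ c))) c 0≤c a≈c (proj₂ (ℕ-above (∑ c)))

  simple? : ∀ θ → Dec (IsSimpleRoot B Φ Δ θ)
  simple? θ = FinP.any? (λ i → Δ i Fin.≟ θ)

  P : Fin m → LinPoly n
  P θ with simple? θ | Δ-sign θ
  ... | yes (i , _) | _       = Xvar i
  ... | no _        | inj₁ θ⁺ = proj₁ (int-coroot-coords θ θ⁺)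
  ... | no _        | inj₂ _  = λ _ → + 0

  P-simple : ∀ i → P (Δ i) ≡ Xvar i
  P-simple i with simple? (Δ i) | Δ-sign (Δ i)
  ... | yes (i' , Δi'≡Δi) | _ = cong Xvar (Δ-injective Δi'≡Δi)
  ... | no ∄i             | _ = ⊥-elim (∄i (i , refl))

  P-nonNeg : ∀ θ j → + 0 ℤ.≤ P θ j
  P-nonNeg θ with simple? θ | Δ-sign θ
  ... | yes (i , _) | _       = Xvar-nonNeg i
  ... | no _        | inj₁ θ⁺ = proj₁ (proj₂ (int-coroot-coords θ θ⁺))
  ... | no _        | inj₂ _  = λ _ → ℤP.≤-refl

  coroot≈P : ∀ θ → Pos θ → coroot B (Φ θ) ≈ lincomb (ι ∘ P θ) α∨
  coroot≈P θ θ⁺ with simple? θ | Δ-sign θ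
  ... | yes (i , Δi≡θ) | _       = λ t → trans (cong (λ a → coroot B (Φ a) t) (sym Δi≡θ)) (sym (lincomb-Xvar i α∨ t))
  ... | no _           | inj₁ θ⁺ = proj₂ (proj₂ (int-coroot-coords θ θ⁺))
  ... | no _           | inj₂ θ⁻ = ⊥-elim (¬pos×neg θ θ⁺ θ⁻)

  coroot-coords-unique : ∀ c c' → lincomb c α∨ ≈ lincomb c' α∨ → ∀ i → c i ≡ c' i
  coroot-coords-unique c c' c≈c' i = *-cancelʳ-pos (corootFactor-pos (α i) (0<∥Φ∥² (Δ i)))
    (coords-unique (λ j → c j * corootFactor (α j)) (λ j → c' j * corootFactor (α j))
      (λ t → trans (sym (lincomb-rescale c (corootFactor ∘ α) α t)) (trans (c≈c' t) (lincomb-rescale c' (corootFactor ∘ α) α t))) i)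

  P-additive : ∀ a b θ → Pos a → Pos b → Pos θ → coroot B (Φ θ) ≈ (coroot B (Φ a) +v coroot B (Φ b)) →
               ∀ j → P θ j ≡ P a j ℤ.+ P b j
  P-additive a b θ a⁺ b⁺ θ⁺ θ∨≈a∨+b∨ j = ι-injective (trans (coroot-coords-unique (ι ∘ P θ) (λ i → ι (P a i) + ι (P b i)) P-sum j)
                                                          (sym (ι-homo-+ (P a j) (P b j))))
    where
    P-sum : lincomb (ι ∘ P θ) α∨ ≈ lincomb (λ i → ι (P a i) + ι (P b i)) α∨
    P-sum t = trans (sym (coroot≈P θ θ⁺ t)) (trans (θ∨≈a∨+b∨ t)
      (trans (cong₂ _+_ (coroot≈P a a⁺ t) (coroot≈P b b⁺ t)) (sym (lincomb-+ (ι ∘ P a) (ι ∘ P b) α∨ t))))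

  positivity : Fin m → ℚ
  positivity a with Δ-sign a
  ... | inj₁ _ = 1ℚ
  ... | inj₂ _ = 0ℚ

  positivity-cases : ∀ a → (positivity a ≡ 1ℚ × Pos a) ⊎ (positivity a ≡ 0ℚ × Neg a)
  positivity-cases a with Δ-sign a
  ... | inj₁ a⁺ = inj₁ (refl , a⁺)
  ... | inj₂ a⁻ = inj₂ (refl , a⁻)

  positivity-pos : ∀ {a} → Pos a → positivity a ≡ 1ℚ
  positivity-pos {a} a⁺ with positivity-cases a
  ... | inj₁ (pa≡1 , _)  = pa≡1
  ... | inj₂ (_ , a⁻)    = ⊥-elim (¬pos×neg a a⁺ a⁻)

  positivity-neg : ∀ {a} → Neg a → positivity a ≡ 0ℚ
  positivity-neg {a} a⁻ with positivity-cases a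
  ... | inj₁ (_ , a⁺)    = ⊥-elim (¬pos×neg a a⁺ a⁻)
  ... | inj₂ (pa≡0 , _)  = pa≡0

  2ρ : Vect d
  2ρ = lincomb positivity Φ

  module TwoRhoPairing (i : Fin n) where
    open SimpleReflection i

    g : Fin m → ℚ
    g a = ⟪ Φ a , α i ⟫

    0<∥αi∥² : 0ℚ < ∥ α i ∥²
    0<∥αi∥² = 0<∥Φ∥² (Δ i)

    g∘σ : ∀ a → g (σ a) ≡ - g a
    g∘σ a = begin
      ⟪ Φ (σ a) , α i ⟫               ≡⟨ ⟪⟫-cong (Φ∘σ a) (λ _ → refl) ⟩
      ⟪ reflect (α i) (Φ a) , α i ⟫   ≡⟨ ⟪⟫-sym _ (α i) ⟩
      ⟪ α i , reflect (α i) (Φ a) ⟫   ≡⟨ ⟪a,reflect⟫ (α i) 0<∥αi∥² (Φ a) ⟩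
      - ⟪ α i , Φ a ⟫                 ≡⟨ cong -_ (⟪⟫-sym (α i) (Φ a)) ⟩
      - g a                           ∎
      where open ≡-Reasoning

    σ-preserves-pos : ∀ a → Pos a → g a < 0ℚ → Pos (σ a)
    σ-preserves-pos a (c , 0≤c , a≈c) ga<0 = pos-if-coord-pos (shift-at-i K c) (σ-coords c a≈c) i
      (subst (0ℚ <_) (sym (shift-at-i-at-i K c)) (begin-strict
        0ℚ       ≡⟨ sym (ℚP.+-identityˡ 0ℚ) ⟩
        0ℚ + 0ℚ  <⟨ ℚP.+-mono-≤-< (0≤c i) (ℚP.neg-antimono-< K<0) ⟩
        c i - K  ∎))
      where
      open ℚP.≤-Reasoning
      K : ℚ
      K = cartan (α i) (Φ a)
      K<0 : K < 0ℚ
      K<0 = cartan-neg (α i) 0<∥αi∥² (subst (_< 0ℚ) (⟪⟫-sym (Φ a) (α i)) ga<0)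

    σ-preserves-neg : ∀ a → Neg a → 0ℚ < g a → Neg (σ a)
    σ-preserves-neg a (c⁻ , 0≤c⁻ , -a≈c⁻) 0<ga =
      neg-if-coord-neg (shift-at-i K (λ j → - c⁻ j)) (σ-coords (λ j → - c⁻ j) (neg-coords c⁻ -a≈c⁻)) i
      (subst (_< 0ℚ) (sym (shift-at-i-at-i K (λ j → - c⁻ j))) (begin-strict
        - c⁻ i - K  <⟨ ℚP.+-mono-≤-< (ℚP.neg-antimono-≤ (0≤c⁻ i)) (ℚP.neg-antimono-< 0<K) ⟩
        0ℚ + 0ℚ     ≡⟨ ℚP.+-identityˡ 0ℚ ⟩
        0ℚ          ∎))
      where
      open ℚP.≤-Reasoning
      K : ℚ
      K = cartan (α i) (Φ a)
      0<K : 0ℚ < K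
      0<K = cartan-pos (α i) 0<∥αi∥² (subst (0ℚ <_) (⟪⟫-sym (Φ a) (α i)) 0<ga)

    -- Reindexing ⟪ 2ρ , αᵢ ⟫ = ∑ₐ positivity a * g a along σ gives twice it as ∑ term; a term is nonzero only
    -- when σ moves a root across the sign divide, which forces g to have the matching sign.
    term : Fin m → ℚ
    term a = (positivity a - positivity (σ a)) * g a

    ⟪2ρ,αi⟫-twice : ⟪ 2ρ , α i ⟫ + ⟪ 2ρ , α i ⟫ ≡ ∑ term
    ⟪2ρ,αi⟫-twice = begin
      ⟪ 2ρ , α i ⟫ + ⟪ 2ρ , α i ⟫
        ≡⟨ cong (λ x → x + x) (⟪⟫-lincombˡ positivity Φ (α i)) ⟩
      S + S
        ≡⟨ cong (_+_ S) (∑-permute (λ a → positivity a * g a) σ-permutation) ⟩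
      S + ∑ (λ a → positivity (σ a) * g (σ a))
        ≡⟨ cong (_+_ S) (∑-cong (λ a → cong (positivity (σ a) *_) (g∘σ a))) ⟩
      S + ∑ (λ a → positivity (σ a) * - g a)
        ≡⟨ sym (∑-distrib-+ (λ a → positivity a * g a) (λ a → positivity (σ a) * - g a)) ⟩
      ∑ (λ a → positivity a * g a + positivity (σ a) * - g a)
        ≡⟨ ∑-cong (λ a → solve 3 (λ p q x → p :* x :+ q :* (:- x) := (p :- q) :* x) refl
                                 (positivity a) (positivity (σ a)) (g a)) ⟩
      ∑ term ∎
      where
      open ≡-Reasoning
      S : ℚ
      S = ∑ (λ a → positivity a * g a)

    term-values : ∀ {a p q} → positivity a ≡ p → positivity (σ a) ≡ q → term a ≡ (p - q) * g a
    term-values {a} pa≡p pσa≡q = cong₂ (λ u v → (u - v) * g a) pa≡p pσa≡q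

    0≤term : ∀ a → 0ℚ ≤ term a
    0≤term a with positivity-cases a | positivity-cases (σ a)
    ... | inj₁ (pa≡1 , _) | inj₁ (pσa≡1 , _) =
      ℚP.≤-reflexive (sym (trans (term-values pa≡1 pσa≡1) (solve 1 (λ x → (con 1ℚ :- con 1ℚ) :* x := con 0ℚ) refl (g a))))
    ... | inj₂ (pa≡0 , _) | inj₂ (pσa≡0 , _) =
      ℚP.≤-reflexive (sym (trans (term-values pa≡0 pσa≡0) (solve 1 (λ x → (con 0ℚ :- con 0ℚ) :* x := con 0ℚ) refl (g a))))
    ... | inj₁ (pa≡1 , a⁺) | inj₂ (pσa≡0 , σa⁻) =
      subst (0ℚ ≤_) (sym (trans (term-values pa≡1 pσa≡0) (solve 1 (λ x → (con 1ℚ :- con 0ℚ) :* x := x) refl (g a))))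
            (ℚP.≮⇒≥ (λ ga<0 → ¬pos×neg (σ a) (σ-preserves-pos a a⁺ ga<0) σa⁻))
    ... | inj₂ (pa≡0 , a⁻) | inj₁ (pσa≡1 , σa⁺) =
      subst (0ℚ ≤_) (sym (trans (term-values pa≡0 pσa≡1) (solve 1 (λ x → (con 0ℚ :- con 1ℚ) :* x := :- x) refl (g a))))
            (ℚP.neg-antimono-≤ (ℚP.≮⇒≥ (λ 0<ga → ¬pos×neg (σ a) σa⁺ (σ-preserves-neg a a⁻ 0<ga))))

    -- σ sends αᵢ to -αᵢ, so αᵢ is the one positive root whose term certainly does not vanish.
    0<term-αi : 0ℚ < term (Δ i)
    0<term-αi = subst (0ℚ <_) (sym (trans (term-values (positivity-pos (simple-pos i)) (positivity-neg σαi⁻))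
                                          (solve 1 (λ x → (con 1ℚ :- con 0ℚ) :* x := x) refl (g (Δ i)))))
                              0<∥αi∥²
      where
      coord-i<0 : shift-at-i (cartan (α i) (α i)) (ι ∘ Xvar i) i < 0ℚ
      coord-i<0 = subst (_< 0ℚ) (sym (trans (shift-at-i-at-i (cartan (α i) (α i)) (ι ∘ Xvar i))
                                            (cong₂ (λ u v → ι u - v) (Xvar-diag i) (cartan-self (α i) 0<∥αi∥²))))
                                (ℚ.*<* ℤ.-<+)
      σαi⁻ : Neg (σ (Δ i))
      σαi⁻ = neg-if-coord-neg (shift-at-i (cartan (α i) (α i)) (ι ∘ Xvar i)) (σ-coords (ι ∘ Xvar i) (simple-coords i)) i coord-i<0

    0<⟪2ρ,αi⟫ : 0ℚ < ⟪ 2ρ , α i ⟫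
    0<⟪2ρ,αi⟫ = 0<x+x⇒0<x (subst (0ℚ <_) (sym ⟪2ρ,αi⟫-twice) (ℚP.<-≤-trans 0<term-αi (term≤∑ 0≤term (Δ i))))

  0<⟪2ρ,θ∨⟫ : ∀ a → Pos a → 0ℚ < ⟪ 2ρ , coroot B (Φ a) ⟫
  0<⟪2ρ,θ∨⟫ a (c , 0≤c , a≈c) = subst (0ℚ <_) (sym (⟪⟫-coroot 2ρ (Φ a))) (*-pos (corootFactor-pos (Φ a) (0<∥Φ∥² a)) 0<⟪2ρ,θ⟫)
    where
    j : Fin n
    j = proj₁ (simple-with-positive-pairing c 0≤c a≈c)
    0<cj : 0ℚ < c j
    0<cj = proj₁ (proj₂ (simple-with-positive-pairing c 0≤c a≈c))
    summand : Fin n → ℚ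
    summand l = c l * ⟪ 2ρ , α l ⟫
    0≤summand : ∀ l → 0ℚ ≤ summand l
    0≤summand l = *-nonNeg (0≤c l) (ℚP.<⇒≤ (TwoRhoPairing.0<⟪2ρ,αi⟫ l))
    0<⟪2ρ,θ⟫ : 0ℚ < ⟪ 2ρ , Φ a ⟫
    0<⟪2ρ,θ⟫ = subst (0ℚ <_) (sym (trans (⟪⟫-cong {2ρ} {2ρ} (λ _ → refl) a≈c) (⟪⟫-lincombʳ c α 2ρ)))
                 (ℚP.<-≤-trans (*-pos 0<cj (TwoRhoPairing.0<⟪2ρ,αi⟫ j)) (term≤∑ 0≤summand j))

  2ρ-bound : ℚ
  2ρ-bound = 1ℚ + ∑ (λ a → ℚ.∣ ⟪ 2ρ , coroot B (Φ a) ⟫ ∣)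

  fundamental-alcove-point : Vect d
  fundamental-alcove-point = inv 2ρ-bound • 2ρ

  fundamental-alcove-point∈Ae : InAe B Φ Δ fundamental-alcove-point
  fundamental-alcove-point∈Ae a a⁺ = subst (λ x → 0ℚ < x × x < 1ℚ) (sym (⟪⟫-•ˡ (inv 2ρ-bound) 2ρ (coroot B (Φ a))))
    (inv*-unit-interval (0<⟪2ρ,θ∨⟫ a a⁺) (<1+∑∣∣ (λ b → ⟪ 2ρ , coroot B (Φ b) ⟫) a))

  pairing-sandwich : ∀ θ → Pos θ → ∀ y ks → (∀ j → ι (ks j) < ⟪ y , α∨ j ⟫ × ⟪ y , α∨ j ⟫ < ι (ks j ℤ.+ + 1)) →
                     ι (evalP (P θ) ks) ≤ ⟪ y , coroot B (Φ θ) ⟫ × ⟪ y , coroot B (Φ θ) ⟫ ≤ ι (evalP (P θ) ks ℤ.+ ∑ℤ (P θ))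
  pairing-sandwich θ θ⁺ y ks bounds =
    subst (ι (evalP (P θ) ks) ≤_) (sym ⟪y,θ∨⟫≡∑) (evalP-≤ (P θ) ks t (P-nonNeg θ) (ℚP.<⇒≤ ∘ proj₁ ∘ bounds)) ,
    subst (_≤ ι (evalP (P θ) ks ℤ.+ ∑ℤ (P θ))) (sym ⟪y,θ∨⟫≡∑) (≤-evalP+∑ℤ (P θ) ks t (P-nonNeg θ) (ℚP.<⇒≤ ∘ proj₂ ∘ bounds))
    where
    t : Fin n → ℚ
    t j = ⟪ y , α∨ j ⟫
    ⟪y,θ∨⟫≡∑ : ⟪ y , coroot B (Φ θ) ⟫ ≡ ∑ (λ j → ι (P θ j) * t j)
    ⟪y,θ∨⟫≡∑ = trans (⟪⟫-cong {y} {y} (λ _ → refl) (coroot≈P θ θ⁺)) (⟪⟫-lincombʳ (ι ∘ P θ) α∨ y)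

  coroot-height≡∑P : ∀ θ → Pos θ → ∀ h → CorootHeight B Φ Δ θ h → h ≡ ι (∑ℤ (P θ))
  coroot-height≡∑P θ θ⁺ h (c , θ∨≈c , h≡∑c) = trans h≡∑c (trans (∑-cong c≡P) (sym (ι-∑ℤ (P θ))))
    where
    c≡P : ∀ j → c j ≡ ι (P θ j)
    c≡P = coroot-coords-unique c (ι ∘ P θ) (λ t → trans (sym (θ∨≈c t)) (coroot≈P θ θ⁺ t))

  k-decomposition : ∀ θ → Pos θ → ∀ w ks kθ → (∀ i → IsK B Φ Δ w (Δ i) (ks i)) → IsK B Φ Δ w θ kθ →
                    ∃ λ (lam : ℕ) → kθ ≡ evalP (P θ) ks ℤ.+ + lam × (∀ h → CorootHeight B Φ Δ θ h → ι (+ lam) < h)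
  k-decomposition θ θ⁺ w ks kθ ks-spec kθ-spec =
    lam , kθ≡E+lam , λ h h-spec → subst (ι (+ lam) <_) (sym (coroot-height≡∑P θ θ⁺ h h-spec)) (ι-mono-< lam<H)
    where
    x₀∈Ae : InAe B Φ Δ fundamental-alcove-point
    x₀∈Ae = fundamental-alcove-point∈Ae
    y : Vect d
    y = act B Φ Δ w fundamental-alcove-point
    E H : ℤ
    E = evalP (P θ) ks
    H = ∑ℤ (P θ)
    sandwich : ι E ≤ ⟪ y , coroot B (Φ θ) ⟫ × ⟪ y , coroot B (Φ θ) ⟫ ≤ ι (E ℤ.+ H)
    sandwich = pairing-sandwich θ θ⁺ y ks (λ j → ks-spec j _ x₀∈Ae)
    between : ∃ λ (lam : ℕ) → kθ ≡ E ℤ.+ + lam × + lam ℤ.< H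
    between = ℤ-between E H kθ (ι-cancel-< (ℚP.<-≤-trans (proj₁ (kθ-spec _ x₀∈Ae)) (proj₂ sandwich)))
                               (ι-cancel-< (ℚP.≤-<-trans (proj₁ sandwich) (proj₂ (kθ-spec _ x₀∈Ae))))
    lam : ℕ
    lam = proj₁ between
    kθ≡E+lam : kθ ≡ E ℤ.+ + lam
    kθ≡E+lam = proj₁ (proj₂ between)
    lam<H : + lam ℤ.< H
    lam<H = proj₂ (proj₂ between)

theorem4p1 : ∀ {d m n : ℕ} (B : Gram d) (Φ : Fin m → Vect d) (Δ : Fin n → Fin m) →
    IsInnerProduct B → IsRootSystem B Φ → IsIrreducible B Φ → ShortRootsNormOne B Φ →
    IsSimpleSystem B Φ Δ →
    Σ (Fin m → LinPoly n) λ P →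
      (∀ i → P (Δ i) ≡ Xvar i) ×
      (∀ θ → Positive B Φ Δ θ → ¬ IsSimpleRoot B Φ Δ θ →
        (∀ j → + 0 ℤ.≤ P θ j) ×
        (∀ (w : Word B Φ Δ) (ks : Fin n → ℤ) (kθ : ℤ) →
          (∀ i → IsK B Φ Δ w (Δ i) (ks i)) → IsK B Φ Δ w θ kθ →
          ∃ λ (lam : ℕ) → (kθ ≡ evalP (P θ) ks ℤ.+ + lam) ×
            (∀ (h : ℚ) → CorootHeight B Φ Δ θ h → ι (+ lam) < h))) ×
      (∀ α β θ → Positive B Φ Δ α → Positive B Φ Δ β → Positive B Φ Δ θ →
        coroot B (Φ θ) ≈ (coroot B (Φ α) +v coroot B (Φ β)) →
        ∀ j → P θ j ≡ P α j ℤ.+ P β j)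
theorem4p1 B Φ Δ (B-sym , B-posDef) (Φ-inj , _ , Φ≉0 , Φ-mult , Φ-refl , Φ-cryst) _ _ (Δ-indep , _ , Δ-sign) =
  P , P-simple , (λ θ θ⁺ _ → P-nonNeg θ , k-decomposition θ θ⁺) , P-additive
  where open RootSystem B Φ Δ B-sym B-posDef Φ-inj Φ≉0 Φ-mult Φ-refl Φ-cryst Δ-indep Δ-sign
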